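{- Let $n\in\mathbb{N}$ and let $n=n_0+n_1$ with integers $n_0\geq n_1\geq 1$. Then $n=n_0+n_1$ is a hypercubic bipartition (HCBP) if and only if $f(n)=n_1+f(n_1)+f(n_0)$.
   Context: $\lg$ denotes the base-2 logarithm. The function $f:\mathbb{N}\to\mathbb{N}_0$ is defined by $f(1)=0$ and $f(n)=\lfloor n/2\rfloor+f(\lfloor n/2\rfloor)+f(\lceil n/2\rceil)$ for $n>1$. For $k\ge 1$ and $i\in\{0,\ldots,2^k-1\}$, $\tilde{\beta}_k(i)\in\{0,1\}^k$ is the point whose coordinates are the binary digits of $i$ written with $k$ digits, the least significant digit being the $k$-th coordinate, the next digit the $(k-1)$-th coordinate, and so on. For $n\ge 2$ and $k=\lceil\lg n\rceil$, a partition $n=n_0+n_1$ with $n_0\ge n_1\ge 1$ is a hypercubic bipartition (HCBP) if there is $i\in\{1,\ldots,k\}$ such that among the $n$ points $\tilde{\beta}_k(0),\ldots,\tilde{\beta}_k(n-1)$ exactly $n_0$ have $i$-th coordinate equal to one value and the other $n_1$ have $i$-th coordinate equal to the other value (i.e. the hyperplane $x_i=1/2$ splits them into parts of sizes $n_0$ and $n_1$). For $n=1$ there are no such partitions. -}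

module Defs where

open import Data.Nat using (ℕ; zero; suc; _+_; _*_; _∸_; _^_; _≤_; _<_; ⌊_/2⌋; ⌈_/2⌉)
open import Data.Nat.DivMod using (_/_; _%_)
open import Data.Nat.Logarithm using (⌈log₂_⌉)
open import Data.Nat.Properties using (_≟_)
open import Data.List using (List; filter; length; upTo)
open import Data.Product using (∃-syntax; _×_)
open import Data.Sum using (_⊎_)
open import Relation.Binary.PropositionalEquality using (_≡_)

-- f(1) = 0, f(n) = ⌊n/2⌋ + f(⌊n/2⌋) + f(⌈n/2⌉) for n > 1.
-- Implemented with a fuel argument; fuel n suffices for argument n
-- (both halves are strictly smaller than n when n ≥ 2).
-- f 0 is irrelevant (f is only specified on ℕ = {1,2,...}); it is 0 here.
fFuel : ℕ → ℕ → ℕ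
fFuel zero _ = 0
fFuel (suc fuel) 0 = 0
fFuel (suc fuel) 1 = 0
fFuel (suc fuel) n@(suc (suc _)) =
  ⌊ n /2⌋ + fFuel fuel ⌊ n /2⌋ + fFuel fuel ⌈ n /2⌉

f : ℕ → ℕ
f n = fFuel n n

-- The i-th coordinate (i ∈ {1,…,k}) of β̃_k(j): the binary digit of j of
-- weight 2^(k-i) (coordinate k is the least significant digit).
-- shiftR m j = ⌊ j / 2^m ⌋
shiftR : ℕ → ℕ → ℕ
shiftR zero j = j
shiftR (suc m) j = shiftR m ⌊ j /2⌋

coord : (k i j : ℕ) → ℕ
coord k i j = shiftR (k ∸ i) j % 2

countCoord : (k i n b : ℕ) → ℕ
countCoord k i n b = length (filter (λ j → coord k i j ≟ b) (upTo n))

-- n = n0 + n1 (n0 ≥ n1 ≥ 1, n ≥ 2) is a hypercubic bipartition: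
-- some hyperplane x_i = 1/2 (1 ≤ i ≤ k = ⌈lg n⌉) splits the n points
-- into parts of sizes n0 and n1.
IsHCBP : (n n0 n1 : ℕ) → Set
IsHCBP n n0 n1 =
  ∃[ i ] (1 ≤ i × i ≤ k ×
    ((countCoord k i n 1 ≡ n0 × countCoord k i n 0 ≡ n1)
     ⊎ (countCoord k i n 0 ≡ n0 × countCoord k i n 1 ≡ n1)))
  where k = ⌈log₂ n ⌉

-- A split n = a + b is tight when f n = f a + f b + a ⊓ b; the right-hand side never exceeds
-- f n. Writing a and b as 2α or 2α + 1, tightness obeys a parity recursion:
-- (2α, 2β) is tight iff (α, β) is, (2α, 2β + 1) iff both (α, β) and (α, β + 1) are, and
-- (2α + 1, 2β + 1) iff α = β. The hyperplane through the bit of weight 2^m cuts {0, …, n - 1}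
-- into the points with that bit set and the rest; the former number min(x, y), where x + y = n
-- is the split with 2^m ∣ x and |x - y| ≤ 2^m. The splits having such an aligned form for some
-- m satisfy the same parity recursion with the same base case a = 0, so they are exactly the
-- tight splits.

module Submission where

open import Defs
open import Data.Nat
open import Data.Nat.Properties
open import Data.Nat.Divisibility
open import Data.Nat.DivMod using (_%_; m%n<n)
open import Data.Nat.Logarithm
  using (⌈log₂_⌉; ⌈log₂⌉-mono-≤; ⌈log₂2^n⌉≡n; ⌈log₂⌈n/2⌉⌉≡⌈log₂n⌉∸1)
open import Data.Nat.Induction using (<-rec)
open import Data.Nat.Tactic.RingSolver using (solve-∀)
open import Data.List using (length; filter; upTo; _++_; [_])
open import Data.List.Properties using (applyUpTo-∷ʳ; filter-++; length-++)
open import Data.Product using (_×_; _,_; proj₁; proj₂; ∃-syntax)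
open import Data.Product.Function.NonDependent.Propositional using (_×-⇔_)
open import Data.Sum using (_⊎_; inj₁; inj₂)
open import Function.Base using (_∘_; id)
open import Function.Bundles using (_⇔_; mk⇔; Equivalence)
open import Function.Construct.Composition using (_⇔-∘_)
open import Function.Construct.Symmetry using (⇔-sym)
open import Relation.Binary.Definitions using (tri<; tri≈; tri>)
open import Relation.Binary.PropositionalEquality
  using (_≡_; _≢_; refl; sym; trans; cong; cong₂; subst; subst₂; module ≡-Reasoning)
open import Relation.Nullary using (¬_; contradiction; yes; no)
open import Relation.Unary using (Decidable)

data EvenOrOdd : ℕ → Set where
  even : ∀ t → EvenOrOdd (2 * t)
  odd  : ∀ t → EvenOrOdd (suc (2 * t))

evenOrOdd : ∀ n → EvenOrOdd n
evenOrOdd zero = even 0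
evenOrOdd (suc n) with evenOrOdd n
... | even t = odd t
... | odd t = subst EvenOrOdd (*-suc 2 t) (even (suc t))

2*n≡n+n : ∀ n → 2 * n ≡ n + n
2*n≡n+n n = cong (n +_) (+-identityʳ n)

⌊2*n/2⌋≡n : ∀ n → ⌊ 2 * n /2⌋ ≡ n
⌊2*n/2⌋≡n n = trans (cong ⌊_/2⌋ (2*n≡n+n n)) (sym (n≡⌊n+n/2⌋ n))

⌈2*n/2⌉≡n : ∀ n → ⌈ 2 * n /2⌉ ≡ n
⌈2*n/2⌉≡n n = trans (cong ⌈_/2⌉ (2*n≡n+n n)) (sym (n≡⌈n+n/2⌉ n))

2*m+[1+2*n]≡1+2*[m+n] : ∀ m n → 2 * m + suc (2 * n) ≡ suc (2 * (m + n))
2*m+[1+2*n]≡1+2*[m+n] m n = trans (+-suc (2 * m) (2 * n)) (cong suc (sym (*-distribˡ-+ 2 m n)))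

⌈1+2*n/2⌉≡1+n : ∀ n → ⌈ suc (2 * n) /2⌉ ≡ suc n
⌈1+2*n/2⌉≡1+n n = cong suc (⌊2*n/2⌋≡n n)

⌊1+2*n/2⌋≡n : ∀ n → ⌊ suc (2 * n) /2⌋ ≡ n
⌊1+2*n/2⌋≡n n = ⌈2*n/2⌉≡n n

fFuel-stable : ∀ {a b} n → n ≤ a → n ≤ b → fFuel a n ≡ fFuel b n
fFuel-stable {zero}  {zero}  zero _ _ = refl
fFuel-stable {zero}  {suc b} zero _ _ = refl
fFuel-stable {suc a} {zero}  zero _ _ = refl
fFuel-stable {suc a} {suc b} zero _ _ = refl
fFuel-stable {suc a} {suc b} (suc zero) _ _ = refl
fFuel-stable {suc a} {suc b} n@(suc (suc k)) (s≤s k<a) (s≤s k<b) =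
  cong₂ (λ u v → ⌊ n /2⌋ + u + v)
    (fFuel-stable ⌊ n /2⌋ (≤-trans (⌊n/2⌋≤⌈n/2⌉ n) ⌈n/2⌉≤a)
                          (≤-trans (⌊n/2⌋≤⌈n/2⌉ n) ⌈n/2⌉≤b))
    (fFuel-stable ⌈ n /2⌉ ⌈n/2⌉≤a ⌈n/2⌉≤b)
  where
  ⌈n/2⌉≤a : ⌈ n /2⌉ ≤ a
  ⌈n/2⌉≤a = ≤-trans (s≤s (⌈n/2⌉≤n k)) k<a
  ⌈n/2⌉≤b : ⌈ n /2⌉ ≤ b
  ⌈n/2⌉≤b = ≤-trans (s≤s (⌈n/2⌉≤n k)) k<b

f-halves : ∀ n → 2 ≤ n → f n ≡ ⌊ n /2⌋ + f ⌊ n /2⌋ + f ⌈ n /2⌉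
f-halves n@(suc (suc k)) (s≤s (s≤s _)) =
  cong₂ (λ u v → ⌊ n /2⌋ + u + v)
    (fFuel-stable ⌊ n /2⌋ (≤-trans (⌊n/2⌋≤⌈n/2⌉ n) ⌈n/2⌉≤1+k) ≤-refl)
    (fFuel-stable ⌈ n /2⌉ ⌈n/2⌉≤1+k ≤-refl)
  where
  ⌈n/2⌉≤1+k : ⌈ n /2⌉ ≤ suc k
  ⌈n/2⌉≤1+k = s≤s (⌈n/2⌉≤n k)

f-double : ∀ t → f (2 * t) ≡ t + f t + f t
f-double zero = refl
f-double t@(suc _) = begin
  f (2 * t)
    ≡⟨ f-halves (2 * t) (*-monoʳ-≤ 2 (s≤s z≤n)) ⟩
  ⌊ 2 * t /2⌋ + f ⌊ 2 * t /2⌋ + f ⌈ 2 * t /2⌉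
    ≡⟨ cong₂ (λ u v → u + f u + f v) (⌊2*n/2⌋≡n t) (⌈2*n/2⌉≡n t) ⟩
  t + f t + f t
    ∎
  where open ≡-Reasoning

f-double-suc : ∀ t → f (suc (2 * t)) ≡ t + f t + f (suc t)
f-double-suc zero = refl
f-double-suc t@(suc _) = begin
  f (suc (2 * t))
    ≡⟨ f-halves (suc (2 * t)) (≤-trans (*-monoʳ-≤ 2 (s≤s z≤n)) (n≤1+n (2 * t))) ⟩
  ⌊ suc (2 * t) /2⌋ + f ⌊ suc (2 * t) /2⌋ + f ⌈ suc (2 * t) /2⌉
    ≡⟨ cong₂ (λ u v → u + f u + f v) (⌊1+2*n/2⌋≡n t) (⌈1+2*n/2⌉≡1+n t) ⟩
  t + f t + f (suc t)
    ∎
  where open ≡-Reasoning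

-- Induction along parities

n≤2*n : ∀ n → n ≤ 2 * n
n≤2*n n = m≤m+n n (n + 0)

n≤1+2*n : ∀ n → n ≤ suc (2 * n)
n≤1+2*n n = ≤-trans (n≤2*n n) (n≤1+n _)

1+n≤1+2*n : ∀ n → suc n ≤ suc (2 * n)
1+n≤1+2*n n = s≤s (n≤2*n n)

1+n<2*[1+n] : ∀ n → suc n < 2 * suc n
1+n<2*[1+n] n = m<m+n (suc n) z<s

module _ (P : ℕ → ℕ → Set)
         (P-zero : ∀ b → P 0 b)
         (P-sym : ∀ {a b} → P a b → P b a)
         (P-double : ∀ {a b} → P a b → P (2 * a) (2 * b))
         (P-double-suc : ∀ {a b} → P a b → P a (suc b) → P (2 * a) (suc (2 * b)))
         (P-odd : ∀ {a b} → P a (suc b) → P (suc a) b → P (suc (2 * a)) (suc (2 * b)))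
         where

  split-step : ∀ a b → (∀ x y → x + y < a + b → P x y) → P a b
  split-step a b ih with evenOrOdd a | evenOrOdd b
  ... | even zero    | _            = P-zero b
  ... | even (suc α) | even zero    = P-sym (P-zero _)
  ... | odd α        | even zero    = P-sym (P-zero _)
  ... | even (suc α) | even (suc β) = P-double (ih (suc α) (suc β) (+-mono-< (1+n<2*[1+n] α) (1+n<2*[1+n] β)))
  ... | even (suc α) | odd β        = P-double-suc (ih (suc α) β (+-mono-<-≤ (1+n<2*[1+n] α) (n≤1+2*n β)))
                                                   (ih (suc α) (suc β) (+-mono-<-≤ (1+n<2*[1+n] α) (1+n≤1+2*n β)))
  ... | odd α        | even (suc β) =
    P-sym (P-double-suc (ih (suc β) α (swap (+-mono-≤-< (n≤1+2*n α) (1+n<2*[1+n] β))))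
                        (ih (suc β) (suc α) (swap (+-mono-≤-< (1+n≤1+2*n α) (1+n<2*[1+n] β)))))
    where
    swap : ∀ {x} → x + suc β < suc (2 * α) + 2 * suc β → suc β + x < suc (2 * α) + 2 * suc β
    swap {x} = subst (_< suc (2 * α) + 2 * suc β) (+-comm x (suc β))
  ... | odd α        | odd β        = P-odd (ih α (suc β) (+-mono-<-≤ (s≤s (n≤2*n α)) (1+n≤1+2*n β)))
                                            (ih (suc α) β (+-mono-≤-< (1+n≤1+2*n α) (s≤s (n≤2*n β))))

  split-induction : ∀ a b → P a b
  split-induction a b = <-rec (λ n → ∀ a b → a + b ≡ n → P a b) step (a + b) a b refl
    where
    step : ∀ n → (∀ {m} → m < n → ∀ a b → a + b ≡ m → P a b) → ∀ a b → a + b ≡ n → P a b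
    step _ rec a b refl = split-step a b (λ x y lt → rec lt x y refl)

-- Tight splits

⊓-double-suc : ∀ a b → (2 * a) ⊓ suc (2 * b) ≡ a ⊓ b + a ⊓ suc b
⊓-double-suc a b with ≤-<-connex a b
... | inj₁ a≤b = begin
  (2 * a) ⊓ suc (2 * b) ≡⟨ m≤n⇒m⊓n≡m (≤-trans (*-monoʳ-≤ 2 a≤b) (n≤1+n _)) ⟩
  2 * a               ≡⟨ 2*n≡n+n a ⟩
  a + a               ≡⟨ cong₂ _+_ (m≤n⇒m⊓n≡m a≤b) (m≤n⇒m⊓n≡m (m≤n⇒m≤1+n a≤b)) ⟨
  a ⊓ b + a ⊓ suc b   ∎
  where open ≡-Reasoning
... | inj₂ b<a = begin
  (2 * a) ⊓ suc (2 * b) ≡⟨ m≥n⇒m⊓n≡n (*-monoʳ-< 2 b<a) ⟩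
  suc (2 * b)         ≡⟨ cong suc (2*n≡n+n b) ⟩
  suc (b + b)         ≡⟨ +-suc b b ⟨
  b + suc b           ≡⟨ cong₂ _+_ (m≥n⇒m⊓n≡n (<⇒≤ b<a)) (m≥n⇒m⊓n≡n b<a) ⟨
  a ⊓ b + a ⊓ suc b   ∎
  where open ≡-Reasoning

[1+2*m]⊓[1+2*n]≡1+2*[m⊓n] : ∀ a b → suc (2 * a) ⊓ suc (2 * b) ≡ suc (2 * (a ⊓ b))
[1+2*m]⊓[1+2*n]≡1+2*[m⊓n] a b = cong suc (sym (*-distribˡ-⊓ 2 a b))

2*[m⊓n]≤m⊓[1+n]+[1+m]⊓n : ∀ a b → 2 * (a ⊓ b) ≤ a ⊓ suc b + suc a ⊓ b
2*[m⊓n]≤m⊓[1+n]+[1+m]⊓n a b = subst (_≤ a ⊓ suc b + suc a ⊓ b) (sym (2*n≡n+n (a ⊓ b)))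
  (+-mono-≤ (⊓-monoʳ-≤ a (n≤1+n b)) (⊓-monoˡ-≤ b (n≤1+n a)))

2*[m⊓n]<m⊓[1+n]+[1+m]⊓n : ∀ {a b} → a ≢ b → 2 * (a ⊓ b) < a ⊓ suc b + suc a ⊓ b
2*[m⊓n]<m⊓[1+n]+[1+m]⊓n {a} {b} a≢b with <-cmp a b
... | tri< a<b _ _
  rewrite m≤n⇒m⊓n≡m (<⇒≤ a<b) | m≤n⇒m⊓n≡m (m≤n⇒m≤1+n (<⇒≤ a<b)) | m≤n⇒m⊓n≡m a<b =
  ≤-reflexive (trans (cong suc (2*n≡n+n a)) (sym (+-suc a a)))
... | tri≈ _ a≡b _ = contradiction a≡b a≢b
... | tri> _ _ b<a
  rewrite m≥n⇒m⊓n≡n (<⇒≤ b<a) | m≥n⇒m⊓n≡n b<a | m≥n⇒m⊓n≡n (m≤n⇒m≤1+n (<⇒≤ b<a)) =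
  ≤-reflexive (cong suc (2*n≡n+n b))

splitValue : ℕ → ℕ → ℕ
splitValue a b = f a + f b + a ⊓ b

Tight : ℕ → ℕ → Set
Tight a b = f (a + b) ≡ splitValue a b

f-double+double : ∀ a b → f (2 * a + 2 * b) ≡ (a + b) + f (a + b) + f (a + b)
f-double+double a b = trans (cong f (sym (*-distribˡ-+ 2 a b))) (f-double (a + b))

f-double+double-suc : ∀ a b → f (2 * a + suc (2 * b)) ≡ (a + b) + f (a + b) + f (a + suc b)
f-double+double-suc a b = begin
  f (2 * a + suc (2 * b))               ≡⟨ cong f (2*m+[1+2*n]≡1+2*[m+n] a b) ⟩
  f (suc (2 * (a + b)))                 ≡⟨ f-double-suc (a + b) ⟩
  (a + b) + f (a + b) + f (suc (a + b)) ≡⟨ cong (λ n → (a + b) + f (a + b) + f n) (+-suc a b) ⟨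
  (a + b) + f (a + b) + f (a + suc b)   ∎
  where open ≡-Reasoning

f-odd+odd : ∀ a b → f (suc (2 * a) + suc (2 * b)) ≡ suc (a + b) + f (a + suc b) + f (suc a + b)
f-odd+odd a b = begin
  f (suc (2 * a) + suc (2 * b))              ≡⟨ cong f 1+2*a+[1+2*b]≡2*[1+a+b] ⟩
  f (2 * suc (a + b))                        ≡⟨ f-double (suc (a + b)) ⟩
  suc (a + b) + f (suc (a + b)) + f (suc a + b) ≡⟨ cong (λ n → suc (a + b) + f n + f (suc a + b)) (+-suc a b) ⟨
  suc (a + b) + f (a + suc b) + f (suc a + b) ∎
  where
  open ≡-Reasoning
  1+2*a+[1+2*b]≡2*[1+a+b] : suc (2 * a) + suc (2 * b) ≡ 2 * suc (a + b)
  1+2*a+[1+2*b]≡2*[1+a+b] = begin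
    suc (2 * a + suc (2 * b)) ≡⟨ cong suc (+-suc (2 * a) (2 * b)) ⟩
    2 + (2 * a + 2 * b)       ≡⟨ cong (2 +_) (*-distribˡ-+ 2 a b) ⟨
    2 + 2 * (a + b)           ≡⟨ *-suc 2 (a + b) ⟨
    2 * suc (a + b)           ∎

splitValue-double : ∀ a b → splitValue (2 * a) (2 * b) ≡ (a + b) + splitValue a b + splitValue a b
splitValue-double a b rewrite f-double a | f-double b | sym (*-distribˡ-⊓ 2 a b) =
  rearrange a b (f a) (f b) (a ⊓ b)
  where
  rearrange : ∀ a b x y m → a + x + x + (b + y + y) + 2 * m ≡ (a + b) + (x + y + m) + (x + y + m)
  rearrange = solve-∀

splitValue-double-suc : ∀ a b →
  splitValue (2 * a) (suc (2 * b)) ≡ (a + b) + splitValue a b + splitValue a (suc b)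
splitValue-double-suc a b rewrite f-double a | f-double-suc b | ⊓-double-suc a b =
  rearrange a b (f a) (f b) (f (suc b)) (a ⊓ b) (a ⊓ suc b)
  where
  rearrange : ∀ a b x y y′ m m′ →
    a + x + x + (b + y + y′) + (m + m′) ≡ (a + b) + (x + y + m) + (x + y′ + m′)
  rearrange = solve-∀

-- The cross term a ⊓ suc b + suc a ⊓ b exceeds 2 * (a ⊓ b) by one unless a ≡ b; it sits on
-- the left so that no subtraction occurs.
splitValue-odd : ∀ a b →
  splitValue (suc (2 * a)) (suc (2 * b)) + (a ⊓ suc b + suc a ⊓ b)
    ≡ suc (a + b) + splitValue a (suc b) + splitValue (suc a) b + 2 * (a ⊓ b)
splitValue-odd a b rewrite f-double-suc a | f-double-suc b | [1+2*m]⊓[1+2*n]≡1+2*[m⊓n] a b =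
  rearrange a b (f a) (f (suc a)) (f b) (f (suc b)) (a ⊓ b) (a ⊓ suc b) (suc a ⊓ b)
  where
  rearrange : ∀ a b x x′ y y′ m k k′ →
    a + x + x′ + (b + y + y′) + suc (2 * m) + (k + k′)
      ≡ suc (a + b) + (x + y′ + k) + (x′ + y + k′) + 2 * m
  rearrange = solve-∀

splitValue-odd-bound : ∀ a b → splitValue a (suc b) ≤ f (a + suc b) → splitValue (suc a) b ≤ f (suc a + b) →
  splitValue (suc (2 * a)) (suc (2 * b)) + (a ⊓ suc b + suc a ⊓ b) ≤ f (suc (2 * a) + suc (2 * b)) + 2 * (a ⊓ b)
splitValue-odd-bound a b p q = begin
  splitValue (suc (2 * a)) (suc (2 * b)) + (a ⊓ suc b + suc a ⊓ b)
    ≡⟨ splitValue-odd a b ⟩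
  suc (a + b) + splitValue a (suc b) + splitValue (suc a) b + 2 * (a ⊓ b)
    ≤⟨ +-monoˡ-≤ (2 * (a ⊓ b)) (+-mono-≤ (+-monoʳ-≤ (suc (a + b)) p) q) ⟩
  suc (a + b) + f (a + suc b) + f (suc a + b) + 2 * (a ⊓ b)
    ≡⟨ cong (_+ 2 * (a ⊓ b)) (f-odd+odd a b) ⟨
  f (suc (2 * a) + suc (2 * b)) + 2 * (a ⊓ b)
    ∎
  where open ≤-Reasoning

splitValue-comm : ∀ a b → splitValue a b ≡ splitValue b a
splitValue-comm a b = cong₂ _+_ (+-comm (f a) (f b)) (⊓-comm a b)

splitValue≤f : ∀ a b → splitValue a b ≤ f (a + b)
splitValue≤f = split-induction (λ a b → splitValue a b ≤ f (a + b))
  (λ b → ≤-reflexive (+-identityʳ (f b)))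
  (λ {a} {b} p → subst₂ _≤_ (splitValue-comm a b) (cong f (+-comm a b)) p)
  (λ {a} {b} p → subst₂ _≤_ (sym (splitValue-double a b)) (sym (f-double+double a b))
                   (+-mono-≤ (+-monoʳ-≤ (a + b) p) p))
  (λ {a} {b} p q → subst₂ _≤_ (sym (splitValue-double-suc a b)) (sym (f-double+double-suc a b))
                   (+-mono-≤ (+-monoʳ-≤ (a + b) p) q))
  (λ {a} {b} p q → +-cancelʳ-≤ (a ⊓ suc b + suc a ⊓ b) _ _
     (≤-trans (splitValue-odd-bound a b p q)
              (+-monoʳ-≤ (f (suc (2 * a) + suc (2 * b))) (2*[m⊓n]≤m⊓[1+n]+[1+m]⊓n a b))))

tight-zero : ∀ b → Tight 0 b
tight-zero b = sym (+-identityʳ (f b))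

tight-sym : ∀ a b → Tight a b → Tight b a
tight-sym a b t = trans (cong f (+-comm b a)) (trans t (splitValue-comm a b))

tight-diagonal : ∀ n → Tight n n
tight-diagonal n = begin
  f (n + n)           ≡⟨ cong f (2*n≡n+n n) ⟨
  f (2 * n)           ≡⟨ f-double n ⟩
  n + f n + f n       ≡⟨ +-assoc n (f n) (f n) ⟩
  n + (f n + f n)     ≡⟨ +-comm n (f n + f n) ⟩
  f n + f n + n       ≡⟨ cong (f n + f n +_) (⊓-idem n) ⟨
  splitValue n n      ∎
  where open ≡-Reasoning

≤-parts-of-≡ : ∀ {s x₁ x₂ y₁ y₂} → x₁ ≤ y₁ → x₂ ≤ y₂ →
               s + y₁ + y₂ ≡ s + x₁ + x₂ → y₁ ≡ x₁ × y₂ ≡ x₂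
≤-parts-of-≡ {s} {x₁} {x₂} {y₁} {y₂} x₁≤y₁ x₂≤y₂ eq =
  y₁≡x₁ , +-cancelˡ-≡ y₁ y₂ x₂ (trans sum-eq (cong (_+ x₂) (sym y₁≡x₁)))
  where
  sum-eq : y₁ + y₂ ≡ x₁ + x₂
  sum-eq = +-cancelˡ-≡ s _ _ (trans (sym (+-assoc s y₁ y₂)) (trans eq (+-assoc s x₁ x₂)))
  y₁≡x₁ : y₁ ≡ x₁
  y₁≡x₁ = ≤-antisym (+-cancelʳ-≤ y₂ y₁ x₁ (≤-trans (≤-reflexive sum-eq) (+-monoʳ-≤ x₁ x₂≤y₂))) x₁≤y₁

tight-double⇔ : ∀ a b → Tight (2 * a) (2 * b) ⇔ Tight a b
tight-double⇔ a b = mk⇔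
  (λ t → proj₁ (≤-parts-of-≡ (splitValue≤f a b) (splitValue≤f a b)
                  (trans (sym (f-double+double a b)) (trans t (splitValue-double a b)))))
  (λ t → trans (f-double+double a b)
          (trans (cong (λ v → (a + b) + v + v) t) (sym (splitValue-double a b))))

tight-double-suc⇔ : ∀ a b → Tight (2 * a) (suc (2 * b)) ⇔ (Tight a b × Tight a (suc b))
tight-double-suc⇔ a b = mk⇔
  (λ t → ≤-parts-of-≡ (splitValue≤f a b) (splitValue≤f a (suc b))
           (trans (sym (f-double+double-suc a b)) (trans t (splitValue-double-suc a b))))
  (λ (t₁ , t₂) → trans (f-double+double-suc a b)
                   (trans (cong₂ (λ v w → (a + b) + v + w) t₁ t₂) (sym (splitValue-double-suc a b))))

tight-odd⇔ : ∀ a b → Tight (suc (2 * a)) (suc (2 * b)) ⇔ a ≡ b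
tight-odd⇔ a b = mk⇔ to (λ { refl → tight-diagonal (suc (2 * a)) })
  where
  value : ℕ
  value = splitValue (suc (2 * a)) (suc (2 * b))
  to : Tight (suc (2 * a)) (suc (2 * b)) → a ≡ b
  to t with a ≟ b
  ... | yes a≡b = a≡b
  ... | no a≢b = contradiction (+-cancelˡ-≤ value _ _ bound) (<⇒≱ (2*[m⊓n]<m⊓[1+n]+[1+m]⊓n a≢b))
    where
    bound : value + (a ⊓ suc b + suc a ⊓ b) ≤ value + 2 * (a ⊓ b)
    bound = subst (λ v → value + (a ⊓ suc b + suc a ⊓ b) ≤ v + 2 * (a ⊓ b)) t
              (splitValue-odd-bound a b (splitValue≤f a (suc b)) (splitValue≤f (suc a) b))

-- Aligned splits

record Aligned (m x y : ℕ) : Set where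
  constructor aligned
  field
    divisible : 2 ^ m ∣ x
    lower : x ≤ y + 2 ^ m
    upper : y ≤ x + 2 ^ m

Dyadic : ℕ → ℕ → Set
Dyadic x y = ∃[ m ] (Aligned m x y ⊎ Aligned m y x)

record Window (m a b : ℕ) : Set where
  constructor window
  field
    divisible : 2 ^ m ∣ a
    lower : a ≤ b + 2 ^ m
    upper : b < a + 2 ^ m

2*m≤1+2*n⇒m≤n : ∀ {x y} → 2 * x ≤ suc (2 * y) → x ≤ y
2*m≤1+2*n⇒m≤n {x} {y} le with x ≤? y
... | yes x≤y = x≤y
... | no x≰y = contradiction le (<⇒≱ (subst (_≤ 2 * x) (*-suc 2 y) (*-monoʳ-≤ 2 (≰⇒> x≰y))))

2∣n⇒2∤1+n : ∀ {n} → 2 ∣ n → ¬ 2 ∣ suc n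
2∣n⇒2∤1+n {n} 2∣n 2∣1+n with ∣1⇒≡1 (∣m+n∣m⇒∣n (subst (2 ∣_) (+-comm 1 n) 2∣1+n) 2∣n)
... | ()

aligned-zero⇔ : ∀ x y → Aligned 0 x y ⇔ (x ≤ suc y × y ≤ suc x)
aligned-zero⇔ x y = mk⇔
  (λ (aligned _ x≤y+1 y≤x+1) → subst (x ≤_) (+-comm y 1) x≤y+1 , subst (y ≤_) (+-comm x 1) y≤x+1)
  (λ (x≤1+y , y≤1+x) → aligned (1∣ x) (subst (x ≤_) (+-comm 1 y) x≤1+y) (subst (y ≤_) (+-comm 1 x) y≤1+x))

¬aligned-odd : ∀ m a y → ¬ Aligned (suc m) (suc (2 * a)) y
¬aligned-odd m a y (aligned 2^[1+m]∣x _ _) = 2∣n⇒2∤1+n (m∣m*n a) (m*n∣⇒m∣ 2 (2 ^ m) 2^[1+m]∣x)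

aligned-double⇔ : ∀ m a b → Aligned (suc m) (2 * a) (2 * b) ⇔ Aligned m a b
aligned-double⇔ m a b = mk⇔
  (λ (aligned d l r) → aligned (*-cancelˡ-∣ 2 d) (halve l) (halve r))
  (λ (aligned d l r) → aligned (*-monoʳ-∣ 2 d) (double l) (double r))
  where
  halve : ∀ {x y} → 2 * x ≤ 2 * y + 2 * 2 ^ m → x ≤ y + 2 ^ m
  halve {x} {y} le = *-cancelˡ-≤ 2 (subst (2 * x ≤_) (sym (*-distribˡ-+ 2 y (2 ^ m))) le)
  double : ∀ {x y} → x ≤ y + 2 ^ m → 2 * x ≤ 2 * y + 2 * 2 ^ m
  double {x} {y} le = subst (2 * x ≤_) (*-distribˡ-+ 2 y (2 ^ m)) (*-monoʳ-≤ 2 le)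

aligned-double-suc⇔ : ∀ m a b → Aligned (suc m) (2 * a) (suc (2 * b)) ⇔ Window m a b
aligned-double-suc⇔ m a b = mk⇔
  (λ (aligned d l r) → window (*-cancelˡ-∣ 2 d)
      (2*m≤1+2*n⇒m≤n (subst (λ v → 2 * a ≤ suc v) (sym (*-distribˡ-+ 2 b (2 ^ m))) l))
      (*-cancelˡ-< 2 b (a + 2 ^ m) (subst (suc (2 * b) ≤_) (sym (*-distribˡ-+ 2 a (2 ^ m))) r)))
  (λ (window d l r) → aligned (*-monoʳ-∣ 2 d)
      (subst (λ v → 2 * a ≤ suc v) (*-distribˡ-+ 2 b (2 ^ m)) (m≤n⇒m≤1+n (*-monoʳ-≤ 2 l)))
      (subst (suc (2 * b) ≤_) (*-distribˡ-+ 2 a (2 ^ m)) (*-monoʳ-< 2 r)))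

window⇒aligned : ∀ {m a b} → Window m a b → Aligned m a b × Aligned m a (suc b)
window⇒aligned (window d l r) = aligned d l (<⇒≤ r) , aligned d (m≤n⇒m≤1+n l) r

aligned-flip-at-edge : ∀ {m x y} → Aligned m x y → y ≡ x + 2 ^ m ⊎ x ≡ y + 2 ^ m → Aligned m y x
aligned-flip-at-edge {m} {x} {y} (aligned d l r) (inj₁ y≡x+p) =
  aligned (subst (2 ^ m ∣_) (sym y≡x+p) (∣m∣n⇒∣m+n d ∣-refl)) r l
aligned-flip-at-edge {m} {x} {y} (aligned d l r) (inj₂ x≡y+p) =
  aligned (∣m+n∣m⇒∣n (subst (2 ^ m ∣_) (trans x≡y+p (+-comm y (2 ^ m))) d) ∣-refl) r l

window⊎flip : ∀ {m a b} → Aligned m a b ⊎ Aligned m b a → Window m a b ⊎ Aligned m b a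
window⊎flip (inj₁ al@(aligned d l r)) with m≤n⇒m<n∨m≡n r
... | inj₁ b<a+p = inj₁ (window d l b<a+p)
... | inj₂ b≡a+p = inj₂ (aligned-flip-at-edge al (inj₁ b≡a+p))
window⊎flip (inj₂ al) = inj₂ al

window⊎flip-suc : ∀ {m a b} → Aligned m a (suc b) ⊎ Aligned m (suc b) a → Window m a b ⊎ Aligned m (suc b) a
window⊎flip-suc (inj₁ al@(aligned d l r)) with m≤n⇒m<n∨m≡n l
... | inj₁ a<1+b+p = inj₁ (window d (≤-pred a<1+b+p) r)
... | inj₂ a≡1+b+p = inj₂ (aligned-flip-at-edge al (inj₂ a≡1+b+p))
window⊎flip-suc (inj₂ al) = inj₂ al

window-one-below : ∀ {a} → 2 ∣ a → Window 1 a (suc a)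
window-one-below {a} 2∣a = window 2∣a (≤-trans (n≤1+n a) (m≤m+n (suc a) 2)) (≤-reflexive (+-comm 2 a))

window-one-above : ∀ {b} → 2 ∣ b → Window 1 (2 + b) b
window-one-above {b} 2∣b =
  window (∣m∣n⇒∣m+n ∣-refl 2∣b) (≤-reflexive (+-comm 2 b)) (≤-trans (n≤1+n (suc b)) (m≤m+n (2 + b) 2))

-- 2 ^ m ∣ b and 2 ^ m′ ∣ suc b force m ≡ 0 or m′ ≡ 0, which leaves a within distance 2 of b.
window-of-flips : ∀ {m m′ a b} → Aligned m b a → Aligned m′ (suc b) a → ∃[ k ] Window k a b
window-of-flips {zero} {m′} {a} {b} (aligned _ b≤a+1 a≤b+1) (aligned d′ 1+b≤a+p _)
  with m≤n⇒m<n∨m≡n (subst (b ≤_) (+-comm a 1) b≤a+1)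
... | inj₁ b<1+a = 0 , window (1∣ a) a≤b+1 (subst (b <_) (+-comm 1 a) b<1+a)
... | inj₂ refl with m′
...   | zero = contradiction 1+b≤a+p (<⇒≱ (subst (_< 2 + a) (+-comm 1 a) ≤-refl))
...   | suc m″ = 1 , window-one-below (∣m+n∣m⇒∣n (m*n∣⇒m∣ 2 (2 ^ m″) d′) ∣-refl)
window-of-flips {suc m} {zero} {a} {b} (aligned d a≤b+p _) (aligned _ 1+b≤a+1 a≤1+b+1)
  with m≤n⇒m<n∨m≡n (subst (a ≤_) (+-comm (suc b) 1) a≤1+b+1)
... | inj₁ a<2+b = 0 , window (1∣ a) (subst (a ≤_) (+-comm 1 b) (≤-pred a<2+b)) 1+b≤a+1
... | inj₂ refl = 1 , window-one-above (m*n∣⇒m∣ 2 (2 ^ m) d)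
window-of-flips {suc m} {suc m′} {a} {b} (aligned d _ _) (aligned d′ _ _) =
  contradiction (m*n∣⇒m∣ 2 (2 ^ m′) d′) (2∣n⇒2∤1+n (m*n∣⇒m∣ 2 (2 ^ m) d))

window-of-dyadic : ∀ {a b} → Dyadic a b → Dyadic a (suc b) → ∃[ k ] Window k a b
window-of-dyadic (m , al₁) (m′ , al₂) with window⊎flip al₁ | window⊎flip-suc al₂
... | inj₁ w  | _        = m , w
... | inj₂ _  | inj₁ w   = m′ , w
... | inj₂ al | inj₂ al′ = window-of-flips al al′

n<2^n : ∀ n → n < 2 ^ n
n<2^n zero = z<s
n<2^n (suc n) = +-mono-≤ (m^n>0 2 n) (≤-trans (n<2^n n) (≤-reflexive (sym (+-identityʳ (2 ^ n)))))

dyadic-zero : ∀ b → Dyadic 0 b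
dyadic-zero b = b , inj₁ (aligned ((2 ^ b) ∣0) z≤n (<⇒≤ (n<2^n b)))

dyadic-sym : ∀ {a b} → Dyadic a b → Dyadic b a
dyadic-sym (m , inj₁ al) = m , inj₂ al
dyadic-sym (m , inj₂ al) = m , inj₁ al

dyadic-double⇔ : ∀ a b → Dyadic (2 * a) (2 * b) ⇔ Dyadic a b
dyadic-double⇔ a b = mk⇔ to from
  where
  halve₀ : ∀ {x y} → Aligned 0 (2 * x) (2 * y) → Aligned 0 x y
  halve₀ {x} {y} al with Equivalence.to (aligned-zero⇔ (2 * x) (2 * y)) al
  ... | l , r = Equivalence.from (aligned-zero⇔ x y)
                  (m≤n⇒m≤1+n (2*m≤1+2*n⇒m≤n l) , m≤n⇒m≤1+n (2*m≤1+2*n⇒m≤n r))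
  to : Dyadic (2 * a) (2 * b) → Dyadic a b
  to (zero , inj₁ al) = 0 , inj₁ (halve₀ al)
  to (zero , inj₂ al) = 0 , inj₂ (halve₀ al)
  to (suc m , inj₁ al) = m , inj₁ (Equivalence.to (aligned-double⇔ m a b) al)
  to (suc m , inj₂ al) = m , inj₂ (Equivalence.to (aligned-double⇔ m b a) al)
  from : Dyadic a b → Dyadic (2 * a) (2 * b)
  from (m , inj₁ al) = suc m , inj₁ (Equivalence.from (aligned-double⇔ m a b) al)
  from (m , inj₂ al) = suc m , inj₂ (Equivalence.from (aligned-double⇔ m b a) al)

dyadic-odd⇔ : ∀ a b → Dyadic (suc (2 * a)) (suc (2 * b)) ⇔ a ≡ b
dyadic-odd⇔ a b = mk⇔ to λ { refl → 0 , inj₁ (Equivalence.from (aligned-zero⇔ _ _) (n≤1+n _ , n≤1+n _)) }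
  where
  halve₀ : ∀ {x y} → Aligned 0 (suc (2 * x)) (suc (2 * y)) → x ≡ y
  halve₀ {x} {y} al with Equivalence.to (aligned-zero⇔ (suc (2 * x)) (suc (2 * y))) al
  ... | s≤s l , s≤s r = ≤-antisym (2*m≤1+2*n⇒m≤n l) (2*m≤1+2*n⇒m≤n r)
  to : Dyadic (suc (2 * a)) (suc (2 * b)) → a ≡ b
  to (zero , inj₁ al) = halve₀ al
  to (zero , inj₂ al) = sym (halve₀ al)
  to (suc m , inj₁ al) = contradiction al (¬aligned-odd m a _)
  to (suc m , inj₂ al) = contradiction al (¬aligned-odd m b _)

dyadic-double-suc⇔ : ∀ a b → Dyadic (2 * a) (suc (2 * b)) ⇔ (Dyadic a b × Dyadic a (suc b))
dyadic-double-suc⇔ a b = mk⇔ to from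
  where
  dyadic-pair : ∀ {m} → Window m a b → Dyadic a b × Dyadic a (suc b)
  dyadic-pair {m} w with window⇒aligned w
  ... | al , al′ = (m , inj₁ al) , (m , inj₁ al′)
  window₀ : Aligned 0 (2 * a) (suc (2 * b)) → Window 0 a b
  window₀ al with Equivalence.to (aligned-zero⇔ (2 * a) (suc (2 * b))) al
  ... | l , s≤s r = window (1∣ a)
    (subst (a ≤_) (+-comm 1 b) (*-cancelˡ-≤ 2 (subst (2 * a ≤_) (sym (*-suc 2 b)) l)))
    (subst (b <_) (+-comm 1 a) (s≤s (*-cancelˡ-≤ 2 r)))
  aligned₀-sym : ∀ {x y} → Aligned 0 x y → Aligned 0 y x
  aligned₀-sym {x} {y} al with Equivalence.to (aligned-zero⇔ x y) al
  ... | l , r = Equivalence.from (aligned-zero⇔ y x) (r , l)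
  to : Dyadic (2 * a) (suc (2 * b)) → Dyadic a b × Dyadic a (suc b)
  to (zero , inj₁ al) = dyadic-pair (window₀ al)
  to (zero , inj₂ al) = dyadic-pair (window₀ (aligned₀-sym al))
  to (suc m , inj₁ al) = dyadic-pair (Equivalence.to (aligned-double-suc⇔ m a b) al)
  to (suc m , inj₂ al) = contradiction al (¬aligned-odd m b _)
  from : Dyadic a b × Dyadic a (suc b) → Dyadic (2 * a) (suc (2 * b))
  from (d , d′) with window-of-dyadic d d′
  ... | m , w = suc m , inj₁ (Equivalence.from (aligned-double-suc⇔ m a b) w)

tight⇔dyadic : ∀ a b → Tight a b ⇔ Dyadic a b
tight⇔dyadic = split-induction (λ a b → Tight a b ⇔ Dyadic a b)
  (λ b → mk⇔ (λ _ → dyadic-zero b) (λ _ → tight-zero b))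
  (λ {a} {b} e → mk⇔ (dyadic-sym ∘ Equivalence.to e ∘ tight-sym b a)
                     (tight-sym a b ∘ Equivalence.from e ∘ dyadic-sym))
  (λ {a} {b} e → ⇔-sym (dyadic-double⇔ a b) ⇔-∘ (e ⇔-∘ tight-double⇔ a b))
  (λ {a} {b} e e′ → ⇔-sym (dyadic-double-suc⇔ a b) ⇔-∘ ((e ×-⇔ e′) ⇔-∘ tight-double-suc⇔ a b))
  (λ {a} {b} _ _ → ⇔-sym (dyadic-odd⇔ a b) ⇔-∘ tight-odd⇔ a b)

-- Counting coordinates

sumBelow : (ℕ → ℕ) → ℕ → ℕ
sumBelow g zero = 0
sumBelow g (suc n) = sumBelow g n + g n

countBelow : (ℕ → ℕ) → ℕ → ℕ → ℕ
countBelow g b n = length (filter (λ j → g j ≟ b) (upTo n))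

countBelow-suc : ∀ g b n → countBelow g b (suc n) ≡ countBelow g b n + length (filter (λ j → g j ≟ b) [ n ])
countBelow-suc g b n = begin
  length (filter P? (upTo (suc n)))              ≡⟨ cong (length ∘ filter P?) (applyUpTo-∷ʳ id n) ⟨
  length (filter P? (upTo n ++ [ n ]))           ≡⟨ cong length (filter-++ P? (upTo n) [ n ]) ⟩
  length (filter P? (upTo n) ++ filter P? [ n ]) ≡⟨ length-++ (filter P? (upTo n)) ⟩
  countBelow g b n + length (filter P? [ n ])    ∎
  where
  open ≡-Reasoning
  P? : Decidable (λ j → g j ≡ b)
  P? j = g j ≟ b

module _ (g : ℕ → ℕ) (g<2 : ∀ j → g j < 2) where

  private
    counts-at : ∀ n → length (filter (λ j → g j ≟ 1) [ n ]) ≡ g n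
                    × length (filter (λ j → g j ≟ 0) [ n ]) + g n ≡ 1
    counts-at n with g n | g<2 n
    ... | 0 | _ = refl , refl
    ... | 1 | _ = refl , refl
    ... | suc (suc _) | s≤s (s≤s ())

  countBelow-one : ∀ n → countBelow g 1 n ≡ sumBelow g n
  countBelow-one zero = refl
  countBelow-one (suc n) = trans (countBelow-suc g 1 n) (cong₂ _+_ (countBelow-one n) (proj₁ (counts-at n)))

  countBelow-zero : ∀ n → countBelow g 0 n + sumBelow g n ≡ n
  countBelow-zero zero = refl
  countBelow-zero (suc n) = begin
    countBelow g 0 (suc n) + (sumBelow g n + g n)          ≡⟨ cong (_+ (sumBelow g n + g n)) (countBelow-suc g 0 n) ⟩
    countBelow g 0 n + z + (sumBelow g n + g n)            ≡⟨ rearrange (countBelow g 0 n) z (sumBelow g n) (g n) ⟩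
    (countBelow g 0 n + sumBelow g n) + (z + g n)          ≡⟨ cong₂ _+_ (countBelow-zero n) (proj₂ (counts-at n)) ⟩
    n + 1                                                  ≡⟨ +-comm n 1 ⟩
    suc n                                                  ∎
    where
    open ≡-Reasoning
    z : ℕ
    z = length (filter (λ j → g j ≟ 0) [ n ])
    rearrange : ∀ c z s x → c + z + (s + x) ≡ (c + s) + (z + x)
    rearrange = solve-∀

sumBelow-halves : ∀ g t → sumBelow (λ j → g ⌊ j /2⌋) (2 * t) ≡ 2 * sumBelow g t
sumBelow-halves g zero = refl
sumBelow-halves g (suc t) = begin
  sumBelow h (2 * suc t)
    ≡⟨ cong (sumBelow h) (*-suc 2 t) ⟩
  sumBelow h (2 * t) + h (2 * t) + h (suc (2 * t))
    ≡⟨ cong₂ _+_ (cong₂ _+_ (sumBelow-halves g t) (cong g (⌊2*n/2⌋≡n t))) (cong g (⌊1+2*n/2⌋≡n t)) ⟩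
  2 * sumBelow g t + g t + g t
    ≡⟨ rearrange (sumBelow g t) (g t) ⟩
  2 * (sumBelow g t + g t)
    ∎
  where
  open ≡-Reasoning
  h : ℕ → ℕ
  h j = g ⌊ j /2⌋
  rearrange : ∀ s x → 2 * s + x + x ≡ 2 * (s + x)
  rearrange = solve-∀

sumBelow-halves-suc : ∀ g t → sumBelow (λ j → g ⌊ j /2⌋) (suc (2 * t)) ≡ sumBelow g (suc t) + sumBelow g t
sumBelow-halves-suc g t = begin
  sumBelow (λ j → g ⌊ j /2⌋) (2 * t) + g ⌊ 2 * t /2⌋
    ≡⟨ cong₂ (λ s u → s + g u) (sumBelow-halves g t) (⌊2*n/2⌋≡n t) ⟩
  2 * sumBelow g t + g t
    ≡⟨ rearrange (sumBelow g t) (g t) ⟩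
  sumBelow g t + g t + sumBelow g t
    ∎
  where
  open ≡-Reasoning
  rearrange : ∀ s x → 2 * s + x ≡ s + x + s
  rearrange = solve-∀

⌊1+n/2⌋≡⌊n/2⌋+n%2 : ∀ n → ⌊ suc n /2⌋ ≡ ⌊ n /2⌋ + n % 2
⌊1+n/2⌋≡⌊n/2⌋+n%2 zero = refl
⌊1+n/2⌋≡⌊n/2⌋+n%2 (suc zero) = refl
⌊1+n/2⌋≡⌊n/2⌋+n%2 (suc (suc n)) = cong suc (⌊1+n/2⌋≡⌊n/2⌋+n%2 n)

⌊m+n/2⌋≡m⊓n : ∀ {x y} → x ≤ suc y → y ≤ suc x → ⌊ x + y /2⌋ ≡ x ⊓ y
⌊m+n/2⌋≡m⊓n {x} {y} x≤1+y y≤1+x with <-cmp x y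
... | tri< x<y _ _ rewrite ≤-antisym y≤1+x x<y =
  trans (cong ⌊_/2⌋ (+-suc x x)) (sym (trans (m≤n⇒m⊓n≡m (n≤1+n x)) (n≡⌈n+n/2⌉ x)))
... | tri≈ _ refl _ = sym (trans (⊓-idem x) (n≡⌊n+n/2⌋ x))
... | tri> _ _ y<x rewrite ≤-antisym x≤1+y y<x = sym (trans (m≥n⇒m⊓n≡n (n≤1+n y)) (n≡⌈n+n/2⌉ y))

bit : ℕ → ℕ → ℕ
bit m j = shiftR m j % 2

ones : ℕ → ℕ → ℕ
ones m = sumBelow (bit m)

ones-zero : ∀ n → ones 0 n ≡ ⌊ n /2⌋
ones-zero zero = refl
ones-zero (suc n) = trans (cong (_+ n % 2) (ones-zero n)) (sym (⌊1+n/2⌋≡⌊n/2⌋+n%2 n))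

ones-aligned : ∀ m {x y} → Aligned m x y → ones m (x + y) ≡ x ⊓ y
ones-aligned zero {x} {y} al with Equivalence.to (aligned-zero⇔ x y) al
... | x≤1+y , y≤1+x = trans (ones-zero (x + y)) (⌊m+n/2⌋≡m⊓n x≤1+y y≤1+x)
ones-aligned (suc m) {x} {y} al with evenOrOdd x | evenOrOdd y
... | odd a  | _ = contradiction al (¬aligned-odd m a y)
... | even a | even b = begin
  ones (suc m) (2 * a + 2 * b) ≡⟨ cong (ones (suc m)) (*-distribˡ-+ 2 a b) ⟨
  ones (suc m) (2 * (a + b))   ≡⟨ sumBelow-halves (bit m) (a + b) ⟩
  2 * ones m (a + b)           ≡⟨ cong (2 *_) (ones-aligned m (Equivalence.to (aligned-double⇔ m a b) al)) ⟩
  2 * (a ⊓ b)                  ≡⟨ *-distribˡ-⊓ 2 a b ⟩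
  (2 * a) ⊓ (2 * b)            ∎
  where open ≡-Reasoning
... | even a | odd b with window⇒aligned (Equivalence.to (aligned-double-suc⇔ m a b) al)
...   | al₁ , al₂ = begin
  ones (suc m) (2 * a + suc (2 * b))         ≡⟨ cong (ones (suc m)) (2*m+[1+2*n]≡1+2*[m+n] a b) ⟩
  ones (suc m) (suc (2 * (a + b)))           ≡⟨ sumBelow-halves-suc (bit m) (a + b) ⟩
  ones m (suc (a + b)) + ones m (a + b)      ≡⟨ cong (λ n → ones m n + ones m (a + b)) (+-suc a b) ⟨
  ones m (a + suc b) + ones m (a + b)        ≡⟨ cong₂ _+_ (ones-aligned m al₂) (ones-aligned m al₁) ⟩
  a ⊓ suc b + a ⊓ b                          ≡⟨ +-comm (a ⊓ suc b) (a ⊓ b) ⟩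
  a ⊓ b + a ⊓ suc b                          ≡⟨ ⊓-double-suc a b ⟨
  (2 * a) ⊓ suc (2 * b)                      ∎
  where open ≡-Reasoning

aligned-split-exists : ∀ m n → ∃[ x ] ∃[ y ] (x + y ≡ n × Aligned m x y)
aligned-split-exists m zero = 0 , 0 , refl , aligned ((2 ^ m) ∣0) z≤n z≤n
aligned-split-exists m (suc n) with aligned-split-exists m n
... | x , y , x+y≡n , al@(aligned d l r) with m≤n⇒m<n∨m≡n r
...   | inj₁ y<x+p = x , suc y , trans (+-suc x y) (cong suc x+y≡n) , aligned d (m≤n⇒m≤1+n l) y<x+p
...   | inj₂ y≡x+p = y , suc x , trans (+-suc y x) (cong suc (trans (+-comm y x) x+y≡n)) ,
                     aligned (Aligned.divisible (aligned-flip-at-edge al (inj₁ y≡x+p))) (m≤n⇒m≤1+n r) 1+x≤y+p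
  where
  1+x≤y+p : suc x ≤ y + 2 ^ m
  1+x≤y+p = ≤-trans (s≤s (subst (x ≤_) (sym y≡x+p) (m≤m+n x (2 ^ m))))
                    (subst (_≤ y + 2 ^ m) (+-comm y 1) (+-monoʳ-≤ y (m^n>0 2 m)))

split-by-min : ∀ {u v x y} → u + v ≡ x + y → u ⊓ v ≡ x → (u ≡ x × v ≡ y) ⊎ (v ≡ x × u ≡ y)
split-by-min {u} {v} {x} {y} u+v≡x+y u⊓v≡x with ≤-total u v
... | inj₁ u≤v = inj₁ (u≡x , +-cancelˡ-≡ x v y (trans (cong (_+ v) (sym u≡x)) u+v≡x+y))
  where
  u≡x : u ≡ x
  u≡x = trans (sym (m≤n⇒m⊓n≡m u≤v)) u⊓v≡x
... | inj₂ v≤u = inj₂ (v≡x , +-cancelʳ-≡ x u y (trans (cong (u +_) (sym v≡x)) (trans u+v≡x+y (+-comm x y))))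
  where
  v≡x : v ≡ x
  v≡x = trans (sym (m≥n⇒m⊓n≡n v≤u)) u⊓v≡x

ones≡⇒dyadic : ∀ m x y → ones m (x + y) ≡ x → Dyadic x y
ones≡⇒dyadic m x y ones≡x with aligned-split-exists m (x + y)
... | u , v , u+v≡x+y , al
  with split-by-min u+v≡x+y (trans (sym (ones-aligned m al)) (trans (cong (ones m) u+v≡x+y) ones≡x))
...   | inj₁ (refl , refl) = m , inj₁ al
...   | inj₂ (refl , refl) = m , inj₂ al

m<n∸1⇒1+m<n : ∀ {m} n → m < n ∸ 1 → suc m < n
m<n∸1⇒1+m<n (suc n) m<n = s≤s m<n

2^m<n⇒m<⌈log₂n⌉ : ∀ m n → 2 ^ m < n → m < ⌈log₂ n ⌉
2^m<n⇒m<⌈log₂n⌉ zero n 1<n = subst (_≤ ⌈log₂ n ⌉) (⌈log₂2^n⌉≡n 1) (⌈log₂⌉-mono-≤ 1<n)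
2^m<n⇒m<⌈log₂n⌉ (suc m) n 2^[1+m]<n =
  m<n∸1⇒1+m<n ⌈log₂ n ⌉
    (subst (m <_) (⌈log₂⌈n/2⌉⌉≡⌈log₂n⌉∸1 n) (2^m<n⇒m<⌈log₂n⌉ m ⌈ n /2⌉ 2^m<⌈n/2⌉))
  where
  2^m<⌈n/2⌉ : 2 ^ m < ⌈ n /2⌉
  2^m<⌈n/2⌉ = subst (_≤ ⌈ n /2⌉) (⌈1+2*n/2⌉≡1+n (2 ^ m)) (⌈n/2⌉-mono 2^[1+m]<n)

bit<2 : ∀ m j → bit m j < 2
bit<2 m j = m%n<n (shiftR m j) 2

countCoord-one : ∀ k i n → countCoord k i n 1 ≡ ones (k ∸ i) n
countCoord-one k i = countBelow-one (bit (k ∸ i)) (bit<2 (k ∸ i))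

countCoord-zero : ∀ k i n → countCoord k i n 0 + ones (k ∸ i) n ≡ n
countCoord-zero k i = countBelow-zero (bit (k ∸ i)) (bit<2 (k ∸ i))

hcbp⇔dyadic : ∀ {n₀ n₁} → n₁ ≤ n₀ → 1 ≤ n₁ → IsHCBP (n₀ + n₁) n₀ n₁ ⇔ Dyadic n₀ n₁
hcbp⇔dyadic {n₀} {n₁} n₁≤n₀ 1≤n₁ = mk⇔ to from
  where
  n k : ℕ
  n = n₀ + n₁
  k = ⌈log₂ n ⌉
  to : IsHCBP n n₀ n₁ → Dyadic n₀ n₁
  to (i , _ , _ , inj₁ (c₁ , _)) = ones≡⇒dyadic (k ∸ i) n₀ n₁ (trans (sym (countCoord-one k i n)) c₁)
  to (i , _ , _ , inj₂ (_ , c₁)) = dyadic-sym (ones≡⇒dyadic (k ∸ i) n₁ n₀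
    (trans (cong (ones (k ∸ i)) (+-comm n₁ n₀)) (trans (sym (countCoord-one k i n)) c₁)))
  n₀<n : n₀ < n
  n₀<n = subst (_≤ n) (+-comm n₀ 1) (+-monoʳ-≤ n₀ 1≤n₁)
  ones≡n₁ : ∀ m → Aligned m n₀ n₁ ⊎ Aligned m n₁ n₀ → ones m n ≡ n₁ × 2 ^ m < n
  ones≡n₁ m (inj₁ al) = trans (ones-aligned m al) (m≥n⇒m⊓n≡n n₁≤n₀) ,
                        ≤-<-trans (∣⇒≤ ⦃ >-nonZero (≤-trans 1≤n₁ n₁≤n₀) ⦄ (Aligned.divisible al)) n₀<n
  ones≡n₁ m (inj₂ al) = trans (cong (ones m) (+-comm n₀ n₁)) (trans (ones-aligned m al) (m≤n⇒m⊓n≡m n₁≤n₀)) ,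
                        ≤-<-trans (≤-trans (∣⇒≤ ⦃ >-nonZero 1≤n₁ ⦄ (Aligned.divisible al)) n₁≤n₀) n₀<n
  from : Dyadic n₀ n₁ → IsHCBP n n₀ n₁
  from (m , al) with ones≡n₁ m al
  ... | ones≡ , 2^m<n = k ∸ m , m<n⇒0<n∸m m<k , m∸n≤m k m , inj₂ (c₀ , c₁)
    where
    m<k : m < k
    m<k = 2^m<n⇒m<⌈log₂n⌉ m n 2^m<n
    ones[k∸[k∸m]]≡n₁ : ones (k ∸ (k ∸ m)) n ≡ n₁
    ones[k∸[k∸m]]≡n₁ = trans (cong (λ j → ones j n) (m∸[m∸n]≡n (<⇒≤ m<k))) ones≡
    c₁ : countCoord k (k ∸ m) n 1 ≡ n₁
    c₁ = trans (countCoord-one k (k ∸ m) n) ones[k∸[k∸m]]≡n₁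
    c₀ : countCoord k (k ∸ m) n 0 ≡ n₀
    c₀ = +-cancelʳ-≡ n₁ _ n₀ (trans (cong (countCoord k (k ∸ m) n 0 +_) (sym ones[k∸[k∸m]]≡n₁))
                                    (countCoord-zero k (k ∸ m) n))

splitValue-≥ : ∀ {a b} → b ≤ a → splitValue a b ≡ b + f b + f a
splitValue-≥ {a} {b} b≤a = begin
  f a + f b + a ⊓ b ≡⟨ cong (f a + f b +_) (m≥n⇒m⊓n≡n b≤a) ⟩
  f a + f b + b     ≡⟨ rearrange (f a) (f b) b ⟩
  b + f b + f a     ∎
  where
  open ≡-Reasoning
  rearrange : ∀ x y z → x + y + z ≡ z + y + x
  rearrange = solve-∀

theorem6 : (n n0 n1 : ℕ) → n ≡ n0 + n1 → n1 ≤ n0 → 1 ≤ n1 →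
           (IsHCBP n n0 n1 ⇔ (f n ≡ n1 + f n1 + f n0))
theorem6 _ n0 n1 refl n1≤n0 1≤n1 =
  tight⇔value ⇔-∘ (⇔-sym (tight⇔dyadic n0 n1) ⇔-∘ hcbp⇔dyadic n1≤n0 1≤n1)
  where
  tight⇔value : Tight n0 n1 ⇔ (f (n0 + n1) ≡ n1 + f n1 + f n0)
  tight⇔value = mk⇔ (λ t → trans t (splitValue-≥ n1≤n0)) (λ e → trans e (sym (splitValue-≥ n1≤n0)))
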